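{- Let $G=(X,Y;E)$ be a connected bipartite permutation graph with bipartition into independent sets $X$ and $Y$, and let $\prec_1,\prec_2$ be linear orderings on $X\cup Y$ defining $G$ as a permutation graph. If the first vertex in $\prec_1$ belongs to $X$, then $G$ can be represented by a permutation diagram $(\mathtt{x}_1,\mathtt{x}_2)$ such that $\mathtt{x}_1$ is consistent with $\prec_1$, $\mathtt{x}_2$ is consistent with $\prec_2$, $\mathtt{x}_2(x)=\mathtt{x}_1(x)+1$ for all $x\in X$, and $\mathtt{x}_2(y)=\mathtt{x}_1(y)-1$ for all $y\in Y$.
   Context: Linear orderings $\prec_1,\prec_2$ on $V$ define $G=(V,E)$ as a permutation graph if for distinct $u,v$: $uv\in E$ iff ($u\prec_1 v$ and $v\prec_2 u$) or ($u\prec_2 v$ and $v\prec_1 u$); a bipartite permutation graph is a bipartite graph for which such orderings exist. A permutation diagram representing $G$ is a pair of injective functions $\mathtt{x}_1,\mathtt{x}_2\colon V\to\mathbb{R}$ such that for all distinct $u,v\in V$: $uv\in E$ iff $(\mathtt{x}_1(u)-\mathtt{x}_1(v))(\mathtt{x}_2(u)-\mathtt{x}_2(v))<0$. $\mathtt{x}_i$ is consistent with $\prec_i$ if $\mathtt{x}_i(u)<\mathtt{x}_i(v)\iff u\prec_i v$ for all $u,v\in V$. -}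

module Defs where

open import Level using (0ℓ)
open import Data.Nat using (ℕ)
open import Data.Fin using (Fin)
open import Data.Bool using (Bool; true; false)
open import Data.Product using (_×_; Σ; ∃)
open import Data.Sum using (_⊎_)
open import Relation.Nullary using (¬_)
open import Relation.Binary.PropositionalEquality using (_≡_; _≢_)
open import Relation.Binary.Core using (Rel)
open import Relation.Binary.Definitions using (Symmetric)
open import Relation.Binary.Structures using (IsStrictTotalOrder)
open import Relation.Binary.Construct.Closure.ReflexiveTransitive using (Star)
open import Function.Bundles using (_⇔_)
open import Function.Definitions using (Injective)
open import Data.Rational using (ℚ; _<_; _*_; _-_; _+_; 1ℚ; 0ℚ)

record Graph (n : ℕ) : Set₁ where
  field
    Adj   : Rel (Fin n) 0ℓ
    sym   : Symmetric Adj
    irrefl : ∀ {u} → ¬ Adj u u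
open Graph public

Connected : ∀ {n} → Graph n → Set
Connected G = ∀ u v → Star (Adj G) u v

-- A bipartition into independent sets X = {v | side v ≡ true}, Y = {v | side v ≡ false}.
IsBipartition : ∀ {n} → Graph n → (Fin n → Bool) → Set
IsBipartition G side = ∀ u v → Adj G u v → side u ≢ side v

LinearOrder : ℕ → Set₁
LinearOrder n = Σ (Rel (Fin n) 0ℓ) λ R → IsStrictTotalOrder _≡_ R

DefinesPermGraph : ∀ {n} → Graph n → Rel (Fin n) 0ℓ → Rel (Fin n) 0ℓ → Set
DefinesPermGraph G _≺₁_ _≺₂_ =
  ∀ u v → u ≢ v → (Adj G u v ⇔ ((u ≺₁ v × v ≺₂ u) ⊎ (u ≺₂ v × v ≺₁ u)))

IsFirst : ∀ {n} → Rel (Fin n) 0ℓ → Fin n → Set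
IsFirst _≺_ f = ∀ v → v ≢ f → f ≺ v

IsPermDiagram : ∀ {n} → Graph n → (Fin n → ℚ) → (Fin n → ℚ) → Set
IsPermDiagram G x₁ x₂ =
  Injective _≡_ _≡_ x₁ × Injective _≡_ _≡_ x₂ ×
  (∀ u v → u ≢ v → (Adj G u v ⇔ ((x₁ u - x₁ v) * (x₂ u - x₂ v) < 0ℚ)))

Consistent : ∀ {n} → (Fin n → ℚ) → Rel (Fin n) 0ℓ → Set
Consistent x _≺_ = ∀ u v → (x u < x v ⇔ u ≺ v)

-- Propagating the position of the first vertex along walks shows that every edge joins an
-- X-vertex to a later Y-vertex in ≺₁. For x₂ = x₁ ± 1 to be consistent with ≺₂ it then suffices
-- that x₁ increases along ≺₁ and that, for x ∈ X before y ∈ Y, x₁ y − x₁ x is less than 2 when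
-- xy is an edge and greater than 2 otherwise. Such an x₁ is built greedily along ≺₁: each vertex
-- goes above all earlier vertices and more than 2 above every earlier non-neighbour in X, plus an
-- overshoot 2^(−rank). The overshoots halve along ≺₁, so those accumulated between the endpoints
-- of an edge never use up the slack of 2.

module Submission where

open import Defs
open import Data.Nat using (ℕ)
open import Data.Fin using (Fin)
open import Data.Bool using (Bool; true; false)
open import Data.Product using (_×_; Σ; ∃; proj₁)
open import Relation.Binary.PropositionalEquality using (_≡_)
open import Data.Rational using (ℚ; _+_; _-_; 1ℚ)

open import Level using (0ℓ)
open import Data.Nat as ℕ using (zero; suc; z≤n; s≤s)
import Data.Nat.Properties as ℕₚ
import Data.Nat.Induction as ℕ
open import Data.Bool using (if_then_else_; not)
open import Data.Bool.Properties using (¬-not)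
open import Data.Rational using (0ℚ; ½; -_; _*_; _<_; _≤_; Positive; positive; negative)
open import Data.Rational.Properties
open import Data.Product using (_,_; proj₂; ∃-syntax)
open import Data.Product.Function.NonDependent.Propositional using (_×-⇔_)
open import Data.Sum using (_⊎_; inj₁; inj₂)
open import Data.Sum.Function.Propositional using (_⊎-⇔_)
open import Data.Empty using (⊥-elim)
open import Data.List using (List; map; filter; _++_; allFin)
open import Data.List.Membership.Propositional using (_∈_)
open import Data.List.Membership.Propositional.Properties
  using (∈-allFin; ∈-++⁺ˡ; ∈-++⁺ʳ; ∈-++⁻; ∈-map∘filter⁺; ∈-map∘filter⁻; ∈-filter⁻)
open import Data.List.Properties using (map-cong-local)
import Data.List.Relation.Unary.All as All
open import Relation.Binary.Bundles using (DecTotalOrder)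
open import Data.List.Extrema (DecTotalOrder.totalOrder ≤-decTotalOrder)
  using (max; xs≤max; ⊥≤max; argmax-sel)
import Data.Fin.Subset as Subset
import Data.Fin.Subset.Properties as Subset
import Data.Vec as Vec
import Data.Vec.Properties as Vec
open import Relation.Nullary using (¬_; Dec; yes; no; does)
open import Relation.Nullary.Decidable using (_×-dec_)
open import Relation.Binary.Core using (Rel)
open import Relation.Binary.Definitions using (Decidable; tri<; tri≈; tri>)
open import Relation.Binary.Structures using (IsStrictPartialOrder; IsStrictTotalOrder)
open import Relation.Binary.PropositionalEquality
  using (_≢_; refl; trans; cong; cong₂; subst; subst₂; module ≡-Reasoning)
  renaming (sym to ≡-sym)
open import Relation.Binary.Construct.Closure.ReflexiveTransitive using (Star; ε; _◅_)
open import Induction.WellFounded using (WellFounded; Acc; acc; module Subrelation)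
import Relation.Binary.Construct.On as On
open import Function.Base using (_∘_)
open import Function.Bundles using (_⇔_; mk⇔; Equivalence)
open import Function.Definitions using (Injective)
import Function.Properties.Equivalence as ⇔

two : ℚ
two = 1ℚ + 1ℚ

p-q+q≡p : ∀ p q → (p - q) + q ≡ p
p-q+q≡p p q = trans (+-assoc p (- q) q) (trans (cong (p +_) (+-inverseˡ q)) (+-identityʳ p))

p-q<0⇔p<q : ∀ {p q} → p - q < 0ℚ ⇔ p < q
p-q<0⇔p<q {p} {q} = mk⇔
  (λ p-q<0 → subst₂ _<_ (p-q+q≡p p q) (+-identityˡ q) (+-monoˡ-< q p-q<0))
  (λ p<q → subst (p - q <_) (+-inverseʳ q) (+-monoˡ-< (- q) p<q))

0<p-q⇔q<p : ∀ {p q} → 0ℚ < p - q ⇔ q < p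
0<p-q⇔q<p {p} {q} = mk⇔
  (λ 0<p-q → subst₂ _<_ (+-identityˡ q) (p-q+q≡p p q) (+-monoˡ-< q 0<p-q))
  (λ q<p → subst (_< p - q) (+-inverseʳ q) (+-monoˡ-< (- q) q<p))

p*q<0⇔ : ∀ p q → p * q < 0ℚ ⇔ ((p < 0ℚ × 0ℚ < q) ⊎ (q < 0ℚ × 0ℚ < p))
p*q<0⇔ p q = mk⇔ to from
  where
  to : p * q < 0ℚ → (p < 0ℚ × 0ℚ < q) ⊎ (q < 0ℚ × 0ℚ < p)
  to pq<0 with <-cmp p 0ℚ | <-cmp q 0ℚ
  ... | tri< p<0 _ _ | tri< q<0 _ _ =
    ⊥-elim (<-asym pq<0 (positive⁻¹ _ {{neg*neg⇒pos p {{negative p<0}} q {{negative q<0}}}}))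
  ... | tri< p<0 _ _ | tri≈ _ refl _ = ⊥-elim (<-irrefl (*-zeroʳ p) pq<0)
  ... | tri< p<0 _ _ | tri> _ _ 0<q = inj₁ (p<0 , 0<q)
  ... | tri≈ _ refl _ | _ = ⊥-elim (<-irrefl (*-zeroˡ q) pq<0)
  ... | tri> _ _ 0<p | tri< q<0 _ _ = inj₂ (q<0 , 0<p)
  ... | tri> _ _ 0<p | tri≈ _ refl _ = ⊥-elim (<-irrefl (*-zeroʳ p) pq<0)
  ... | tri> _ _ 0<p | tri> _ _ 0<q =
    ⊥-elim (<-asym pq<0 (positive⁻¹ _ {{pos*pos⇒pos p {{positive 0<p}} q {{positive 0<q}}}}))
  from : (p < 0ℚ × 0ℚ < q) ⊎ (q < 0ℚ × 0ℚ < p) → p * q < 0ℚ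
  from (inj₁ (p<0 , 0<q)) = negative⁻¹ _ {{neg*pos⇒neg p {{negative p<0}} q {{positive 0<q}}}}
  from (inj₂ (q<0 , 0<p)) = negative⁻¹ _ {{pos*neg⇒neg p {{positive 0<p}} q {{negative q<0}}}}

[p-q]*[r-s]<0⇔ : ∀ p q r s → (p - q) * (r - s) < 0ℚ ⇔ ((p < q × s < r) ⊎ (r < s × q < p))
[p-q]*[r-s]<0⇔ p q r s = ⇔.trans (p*q<0⇔ (p - q) (r - s))
  ((p-q<0⇔p<q ×-⇔ 0<p-q⇔q<p) ⊎-⇔ (p-q<0⇔p<q ×-⇔ 0<p-q⇔q<p))

p+w≤q⇒p<q : ∀ {p q w} → p + w ≤ q → 0ℚ < w → p < q
p+w≤q⇒p<q {p} {q} {w} p+w≤q 0<w =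
  <-≤-trans (subst (_< p + w) (+-identityʳ p) (+-monoʳ-< p 0<w)) p+w≤q

p+w+w≤q : ∀ p w {q w′} → p + w′ ≤ q → w + w ≤ w′ → (p + w) + w ≤ q
p+w+w≤q p w {q} p+w′≤q w+w≤w′ =
  subst (_≤ q) (≡-sym (+-assoc p w w)) (≤-trans (+-monoʳ-≤ p w+w≤w′) p+w′≤q)

p+2+q≡p+q+2 : ∀ p q → (p + two) + q ≡ (p + q) + two
p+2+q≡p+q+2 p q = begin
  (p + two) + q ≡⟨ +-assoc p two q ⟩
  p + (two + q) ≡⟨ cong (p +_) (+-comm two q) ⟩
  p + (q + two) ≡⟨ +-assoc p q two ⟨
  (p + q) + two ∎
  where open ≡-Reasoning

p+2-1≡p+1 : ∀ p → (p + two) - 1ℚ ≡ p + 1ℚ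
p+2-1≡p+1 p = +-assoc p two (- 1ℚ)

p+2<q⇒p+1<q-1 : ∀ p {q} → p + two < q → p + 1ℚ < q - 1ℚ
p+2<q⇒p+1<q-1 p {q} h = subst (_< q - 1ℚ) (p+2-1≡p+1 p) (+-monoˡ-< (- 1ℚ) h)

q<p+2⇒q-1<p+1 : ∀ p {q} → q < p + two → q - 1ℚ < p + 1ℚ
q<p+2⇒q-1<p+1 p {q} h = subst (q - 1ℚ <_) (p+2-1≡p+1 p) (+-monoˡ-< (- 1ℚ) h)

p<q⇒p-1<q+1 : ∀ {p q} → p < q → p - 1ℚ < q + 1ℚ
p<q⇒p-1<q+1 {p} {q} p<q = begin-strict
  p - 1ℚ <⟨ +-monoʳ-< p (negative⁻¹ (- 1ℚ)) ⟩
  p + 0ℚ ≡⟨ +-identityʳ p ⟩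
  p      <⟨ p<q ⟩
  q      ≡⟨ +-identityʳ q ⟨
  q + 0ℚ <⟨ +-monoʳ-< q (positive⁻¹ 1ℚ) ⟩
  q + 1ℚ ∎
  where open ≤-Reasoning

½^_ : ℕ → ℚ
½^ zero = 1ℚ
½^ suc k = ½^ k * ½

½^-positive : ∀ k → Positive (½^ k)
½^-positive zero = _
½^-positive (suc k) = pos*pos⇒pos (½^ k) {{½^-positive k}} ½

0<½^ : ∀ k → 0ℚ < ½^ k
0<½^ k = positive⁻¹ (½^ k) {{½^-positive k}}

½^[1+k]+½^[1+k]≡½^k : ∀ k → ½^ suc k + ½^ suc k ≡ ½^ k
½^[1+k]+½^[1+k]≡½^k k = trans (≡-sym (*-distribˡ-+ (½^ k) ½ ½)) (*-identityʳ (½^ k))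

½^-antitone : ∀ {k j} → k ℕ.≤ j → ½^ j ≤ ½^ k
½^-antitone {zero} {zero} _ = ≤-refl
½^-antitone {zero} {suc j} _ = ≤-trans half≤ (½^-antitone {zero} {j} z≤n)
  where
  half≤ : ½^ suc j ≤ ½^ j
  half≤ = subst (½^ suc j ≤_) (½^[1+k]+½^[1+k]≡½^k j)
            (subst (_≤ ½^ suc j + ½^ suc j) (+-identityʳ (½^ suc j))
              (+-monoʳ-≤ (½^ suc j) (<⇒≤ (0<½^ (suc j)))))
½^-antitone {suc k} {suc j} (s≤s k≤j) = *-monoʳ-≤-nonNeg ½ (½^-antitone k≤j)

½^k+½^k≤2 : ∀ k → ½^ k + ½^ k ≤ two
½^k+½^k≤2 k = +-mono-≤ (½^-antitone {zero} {k} z≤n) (½^-antitone {zero} {k} z≤n)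

m<k⇒½^k+½^k≤½^m : ∀ {m k} → m ℕ.< k → ½^ k + ½^ k ≤ ½^ m
m<k⇒½^k+½^k≤½^m {m} {suc k} (s≤s m≤k) =
  subst (_≤ ½^ m) (≡-sym (½^[1+k]+½^[1+k]≡½^k k)) (½^-antitone m≤k)

module Rank {n ℓ} {_⊏_ : Rel (Fin n) ℓ}
  (⊏-isStrictPartialOrder : IsStrictPartialOrder _≡_ _⊏_) (_⊏?_ : Decidable _⊏_) where

  module ⊏ = IsStrictPartialOrder ⊏-isStrictPartialOrder

  below : Fin n → Subset.Subset n
  below v = Vec.tabulate λ u → does (u ⊏? v)

  does≡true⇔ : ∀ {P : Set ℓ} (P? : Dec P) → does P? ≡ true ⇔ P
  does≡true⇔ (yes p) = mk⇔ (λ _ → p) (λ _ → refl)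
  does≡true⇔ (no ¬p) = mk⇔ (λ ()) (⊥-elim ∘ ¬p)

  ∈below⇔ : ∀ {u v} → u Subset.∈ below v ⇔ u ⊏ v
  ∈below⇔ {u} {v} = mk⇔
    (λ u∈ → Equivalence.to (does≡true⇔ (u ⊏? v))
              (trans (≡-sym (Vec.lookup∘tabulate _ u)) (Vec.[]=⇒lookup u∈)))
    (λ u⊏v → Vec.lookup⇒[]= u (below v)
              (trans (Vec.lookup∘tabulate _ u) (Equivalence.from (does≡true⇔ (u ⊏? v)) u⊏v)))

  rank : Fin n → ℕ
  rank v = Subset.∣ below v ∣

  rank-mono : ∀ {u v} → u ⊏ v → rank u ℕ.< rank v
  rank-mono {u} {v} u⊏v = Subset.p⊂q⇒∣p∣<∣q∣
    ( (λ w∈ → Equivalence.from ∈below⇔ (⊏.trans (Equivalence.to ∈below⇔ w∈) u⊏v))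
    , u , Equivalence.from ∈below⇔ u⊏v , ⊏.irrefl refl ∘ Equivalence.to ∈below⇔ )

  rank<n : ∀ v → rank v ℕ.< n
  rank<n v = subst (rank v ℕ.<_) (Subset.∣⊤∣≡n n)
    (Subset.p⊂q⇒∣p∣<∣q∣ (Subset.⊆⊤ , v , Subset.∈⊤ , ⊏.irrefl refl ∘ Equivalence.to ∈below⇔))

  ⊏-wellFounded : WellFounded _⊏_
  ⊏-wellFounded = Subrelation.wellFounded rank-mono (On.wellFounded rank ℕ.<-wellFounded)

module _ {n} {_≺_ : Rel (Fin n) 0ℓ} (≺-isStrictTotalOrder : IsStrictTotalOrder _≡_ _≺_)
  {x : Fin n → ℚ} where

  open IsStrictTotalOrder ≺-isStrictTotalOrder

  strictlyMonotone⇒consistent : (∀ {u v} → u ≺ v → x u < x v) → Consistent x _≺_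
  strictlyMonotone⇒consistent mono u v = mk⇔ to mono
    where
    to : x u < x v → u ≺ v
    to xu<xv with compare u v
    ... | tri< u≺v _ _ = u≺v
    ... | tri≈ _ refl _ = ⊥-elim (<-irrefl refl xu<xv)
    ... | tri> _ _ v≺u = ⊥-elim (<-asym xu<xv (mono v≺u))

  consistent⇒injective : Consistent x _≺_ → Injective _≡_ _≡_ x
  consistent⇒injective cons {u} {v} xu≡xv with compare u v
  ... | tri< u≺v _ _ = ⊥-elim (<-irrefl xu≡xv (Equivalence.from (cons u v) u≺v))
  ... | tri≈ _ u≡v _ = u≡v
  ... | tri> _ _ v≺u = ⊥-elim (<-irrefl (≡-sym xu≡xv) (Equivalence.from (cons v u) v≺u))

consistent⇒IsPermDiagram : ∀ {n} (G : Graph n) (O₁ O₂ : LinearOrder n)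
  → DefinesPermGraph G (proj₁ O₁) (proj₁ O₂)
  → ∀ {x₁ x₂} → Consistent x₁ (proj₁ O₁) → Consistent x₂ (proj₁ O₂)
  → IsPermDiagram G x₁ x₂
consistent⇒IsPermDiagram G O₁ O₂ dpg {x₁} {x₂} cons₁ cons₂ =
  consistent⇒injective (proj₂ O₁) cons₁ , consistent⇒injective (proj₂ O₂) cons₂ , edges
  where
  edges : ∀ u v → u ≢ v → Adj G u v ⇔ ((x₁ u - x₁ v) * (x₂ u - x₂ v) < 0ℚ)
  edges u v u≢v = ⇔.trans (dpg u v u≢v) (⇔.trans
    ((⇔.sym (cons₁ u v) ×-⇔ ⇔.sym (cons₂ v u)) ⊎-⇔ (⇔.sym (cons₂ u v) ×-⇔ ⇔.sym (cons₁ v u)))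
    (⇔.sym ([p-q]*[r-s]<0⇔ (x₁ u) (x₁ v) (x₂ u) (x₂ v))))

module BipartitePermutationGraph {n} (G : Graph n) (side : Fin n → Bool)
  (bip : IsBipartition G side) (O₁ O₂ : LinearOrder n)
  (dpg : DefinesPermGraph G (proj₁ O₁) (proj₁ O₂)) where

  _≺₁_ _≺₂_ : Rel (Fin n) 0ℓ
  _≺₁_ = proj₁ O₁
  _≺₂_ = proj₁ O₂

  module ≺₁ = IsStrictTotalOrder (proj₂ O₁)
  module ≺₂ = IsStrictTotalOrder (proj₂ O₂)

  _≺₁?_ : Decidable _≺₁_
  _≺₁?_ = ≺₁._<?_

  adj⇒≢ : ∀ {u v} → Adj G u v → u ≢ v
  adj⇒≢ uv refl = irrefl G uv

  adj-≺₁⇒≻₂ : ∀ {u v} → Adj G u v → u ≺₁ v → v ≺₂ u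
  adj-≺₁⇒≻₂ {u} {v} uv u≺₁v with Equivalence.to (dpg u v (adj⇒≢ uv)) uv
  ... | inj₁ (_ , v≺₂u) = v≺₂u
  ... | inj₂ (_ , v≺₁u) = ⊥-elim (≺₁.asym u≺₁v v≺₁u)

  ≺₁-≻₂⇒adj : ∀ {u v} → u ≺₁ v → v ≺₂ u → Adj G u v
  ≺₁-≻₂⇒adj {u} {v} u≺₁v v≺₂u =
    Equivalence.from (dpg u v (λ u≡v → ≺₁.irrefl u≡v u≺₁v)) (inj₁ (u≺₁v , v≺₂u))

  sameSide-≺₁⇒≺₂ : ∀ {u v} → side u ≡ side v → u ≺₁ v → u ≺₂ v
  sameSide-≺₁⇒≺₂ {u} {v} su≡sv u≺₁v with ≺₂.compare u v
  ... | tri< u≺₂v _ _ = u≺₂v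
  ... | tri≈ _ refl _ = ⊥-elim (≺₁.irrefl refl u≺₁v)
  ... | tri> _ _ v≺₂u = ⊥-elim (bip u v (≺₁-≻₂⇒adj u≺₁v v≺₂u) su≡sv)

  sameSide-≺₂⇒≺₁ : ∀ {u v} → side u ≡ side v → u ≺₂ v → u ≺₁ v
  sameSide-≺₂⇒≺₁ {u} {v} su≡sv u≺₂v with ≺₁.compare u v
  ... | tri< u≺₁v _ _ = u≺₁v
  ... | tri≈ _ refl _ = ⊥-elim (≺₂.irrefl refl u≺₂v)
  ... | tri> _ _ v≺₁u = ⊥-elim (bip v u (≺₁-≻₂⇒adj v≺₁u u≺₂v) (≡-sym su≡sv))

  adj-≺₁-chain : ∀ {u v w} → u ≺₁ v → v ≺₁ w → Adj G u v → Adj G v w → Adj G u w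
  adj-≺₁-chain u≺v v≺w uv vw =
    ≺₁-≻₂⇒adj (≺₁.trans u≺v v≺w) (≺₂.trans (adj-≺₁⇒≻₂ vw v≺w) (adj-≺₁⇒≻₂ uv u≺v))

  -- u and w both lie on the side opposite to v, yet the chain would make them adjacent.
  ¬adj-≺₁-chain : ∀ {u v w} → u ≺₁ v → v ≺₁ w → Adj G u v → ¬ Adj G v w
  ¬adj-≺₁-chain {u} {v} {w} u≺v v≺w uv vw = bip u w (adj-≺₁-chain u≺v v≺w uv vw)
    (trans (¬-not (bip u v uv)) (≡-sym (¬-not (bip w v (Graph.sym G vw)))))

  adj-moveˡ : ∀ {x a y} → side x ≡ side a → x ≺₁ a → a ≺₁ y → Adj G x y → Adj G a y
  adj-moveˡ sx≡sa x≺a a≺y xy =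
    ≺₁-≻₂⇒adj a≺y (≺₂.trans (adj-≺₁⇒≻₂ xy (≺₁.trans x≺a a≺y)) (sameSide-≺₁⇒≺₂ sx≡sa x≺a))

  adj-moveʳ : ∀ {x z y} → side z ≡ side y → x ≺₁ z → z ≺₁ y ⊎ z ≡ y → Adj G x y → Adj G x z
  adj-moveʳ sz≡sy x≺z (inj₁ z≺y) xy =
    ≺₁-≻₂⇒adj x≺z (≺₂.trans (sameSide-≺₁⇒≺₂ sz≡sy z≺y) (adj-≺₁⇒≻₂ xy (≺₁.trans x≺z z≺y)))
  adj-moveʳ _ _ (inj₂ refl) xy = xy

  Oriented : Fin n → Fin n → Set
  Oriented u v = if side u then u ≺₁ v else v ≺₁ u

  oriented-step : ∀ {u v w} → Oriented u v → Adj G u v → Adj G v w → Oriented v w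
  oriented-step {u} {v} {w} o uv vw with side u in su | side v in sv
  ... | true  | true  = ⊥-elim (bip u v uv (trans su (≡-sym sv)))
  ... | false | false = ⊥-elim (bip u v uv (trans su (≡-sym sv)))
  ... | true  | false with ≺₁.compare w v
  ...   | tri< w≺v _ _ = w≺v
  ...   | tri≈ _ refl _ = ⊥-elim (irrefl G vw)
  ...   | tri> _ _ v≺w = ⊥-elim (¬adj-≺₁-chain o v≺w uv vw)
  oriented-step {u} {v} {w} o uv vw | false | true with ≺₁.compare v w
  ...   | tri< v≺w _ _ = v≺w
  ...   | tri≈ _ refl _ = ⊥-elim (irrefl G vw)
  ...   | tri> _ _ w≺v =
    ⊥-elim (¬adj-≺₁-chain w≺v o (Graph.sym G vw) (Graph.sym G uv))

  OrientedAt : Fin n → Set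
  OrientedAt u = ∀ {v} → Adj G u v → Oriented u v

  orientedAt-walk : ∀ {u v} → OrientedAt u → Star (Adj G) u v → OrientedAt v
  orientedAt-walk o ε = o
  orientedAt-walk o (uv ◅ walk) = orientedAt-walk (oriented-step (o uv) uv) walk

  X-precedes-neighbours : Connected G → ∀ {f} → IsFirst _≺₁_ f → side f ≡ true
    → ∀ {x y} → side x ≡ true → Adj G x y → x ≺₁ y
  X-precedes-neighbours conn {f} first sf {x} {y} sx xy =
    subst (λ b → if b then x ≺₁ y else y ≺₁ x) sx (orientedAt-walk orientedAt-f (conn f x) xy)
    where
    orientedAt-f : OrientedAt f
    orientedAt-f {v} fv =
      subst (λ b → if b then f ≺₁ v else v ≺₁ f) (≡-sym sf) (first v (adj⇒≢ fv ∘ ≡-sym))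

  Separated : Fin n → Fin n → Set
  Separated a v = side a ≡ true × side v ≡ false × a ≺₁ v × a ≺₂ v

  separated? : Decidable Separated
  separated? a v =
    (side a Data.Bool.≟ true) ×-dec (side v Data.Bool.≟ false) ×-dec (a ≺₁.<? v) ×-dec (a ≺₂.<? v)

  separated⇒≺₁ : ∀ {a v} → Separated a v → a ≺₁ v
  separated⇒≺₁ (_ , _ , a≺₁v , _) = a≺₁v

  separated⇒¬adj : ∀ {a v} → Separated a v → ¬ Adj G a v
  separated⇒¬adj (_ , _ , a≺₁v , a≺₂v) av = ≺₂.asym a≺₂v (adj-≺₁⇒≻₂ av a≺₁v)

  separated-≺₁-neighbours : ∀ {a v x} → Separated a v → side x ≡ true → Adj G x v → a ≺₁ x
  separated-≺₁-neighbours {a} {v} {x} sep@(sa , _ , a≺v , _) sx xv with ≺₁.compare a x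
  ... | tri< a≺x _ _ = a≺x
  ... | tri≈ _ refl _ = ⊥-elim (separated⇒¬adj sep xv)
  ... | tri> _ _ x≺a = ⊥-elim (separated⇒¬adj sep (adj-moveˡ (trans sx (≡-sym sa)) x≺a a≺v xv))

  module Coordinates (X-first : ∀ {x y} → side x ≡ true → Adj G x y → x ≺₁ y) where

    open Rank ≺₁.isStrictPartialOrder _≺₁?_

    weight : Fin n → ℚ
    weight v = ½^ rank v

    constraints : (Fin n → ℚ) → Fin n → List ℚ
    constraints h v = map h (filter (_≺₁? v) (allFin n))
                   ++ map (λ a → h a + two) (filter (λ a → separated? a v) (allFin n))

    step : (Fin n → ℚ) → Fin n → ℚ
    step h v = max 0ℚ (constraints h v) + weight v

    step-local : ∀ {h h′ v} → (∀ {u} → u ≺₁ v → h u ≡ h′ u) → step h v ≡ step h′ v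
    step-local {h} {h′} {v} h≡h′ = cong (λ cs → max 0ℚ cs + weight v) (cong₂ _++_
      (map-cong-local (All.tabulate (h≡h′ ∘ proj₂ ∘ ∈-filter⁻ (_≺₁? v) {xs = allFin n})))
      (map-cong-local (All.tabulate
        (cong (_+ two) ∘ h≡h′ ∘ separated⇒≺₁ ∘ proj₂
          ∘ ∈-filter⁻ (λ a → separated? a v) {xs = allFin n}))))

    approx : ℕ → Fin n → ℚ
    approx zero _ = 0ℚ
    approx (suc k) = step (approx k)

    approx-stable : ∀ {k j v} → rank v ℕ.< k → k ℕ.≤ j → approx j v ≡ approx k v
    approx-stable {suc k} {suc j} rv<1+k (s≤s k≤j) = step-local λ u≺v →
      approx-stable (ℕₚ.<-≤-trans (rank-mono u≺v) (ℕₚ.≤-pred rv<1+k)) k≤j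

    x₁ : Fin n → ℚ
    x₁ = approx n

    x₁-unfold : ∀ v → x₁ v ≡ step x₁ v
    x₁-unfold v = trans (approx-stable ℕₚ.≤-refl (rank<n v)) (step-local λ u≺v →
      ≡-sym (approx-stable (rank-mono u≺v) (ℕₚ.<⇒≤ (rank<n v))))

    ∈-constraints⁻ : ∀ {h v c} → c ∈ constraints h v
      → (∃[ u ] u ≺₁ v × c ≡ h u) ⊎ (∃[ a ] Separated a v × c ≡ h a + two)
    ∈-constraints⁻ {h} {v} c∈ with ∈-++⁻ (map h (filter (_≺₁? v) (allFin n))) c∈
    ... | inj₁ c∈ˡ with u , _ , c≡ , u≺v ← ∈-map∘filter⁻ h (_≺₁? v) {xs = allFin n} c∈ˡ =
      inj₁ (u , u≺v , c≡)
    ... | inj₂ c∈ʳ with a , _ , c≡ , sep ←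
      ∈-map∘filter⁻ (λ a → h a + two) (λ a → separated? a v) {xs = allFin n} c∈ʳ =
      inj₂ (a , sep , c≡)

    x₁-above : ∀ {v c} → c ∈ constraints x₁ v → c + weight v ≤ x₁ v
    x₁-above {v} {c} c∈ = subst (c + weight v ≤_) (≡-sym (x₁-unfold v))
      (+-monoˡ-≤ (weight v) (All.lookup (xs≤max 0ℚ (constraints x₁ v)) c∈))

    x₁-step : ∀ {u v} → u ≺₁ v → x₁ u + weight v ≤ x₁ v
    x₁-step {u} {v} u≺v =
      x₁-above (∈-++⁺ˡ (∈-map∘filter⁺ x₁ (_≺₁? v) (u , ∈-allFin u , refl , u≺v)))

    x₁-mono : ∀ {u v} → u ≺₁ v → x₁ u < x₁ v
    x₁-mono {v = v} u≺v = p+w≤q⇒p<q (x₁-step u≺v) (0<½^ (rank v))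

    x₁-separated : ∀ {a v} → Separated a v → x₁ a + two < x₁ v
    x₁-separated {a} {v} sep = p+w≤q⇒p<q
      (x₁-above (∈-++⁺ʳ (map x₁ (filter (_≺₁? v) (allFin n)))
        (∈-map∘filter⁺ (λ a → x₁ a + two) (λ a → separated? a v) (a , ∈-allFin a , refl , sep))))
      (0<½^ (rank v))

    x₁-nonneg : ∀ v → 0ℚ ≤ x₁ v
    x₁-nonneg v = subst (0ℚ ≤_) (≡-sym (x₁-unfold v)) (begin
      0ℚ              ≤⟨ ⊥≤max 0ℚ (constraints x₁ v) ⟩
      M               ≡⟨ +-identityʳ M ⟨
      M + 0ℚ          ≤⟨ +-monoʳ-≤ M (<⇒≤ (0<½^ (rank v))) ⟩
      M + weight v    ∎)
      where
      M : ℚ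
      M = max 0ℚ (constraints x₁ v)
      open ≤-Reasoning

    -- Induction along ≺₁ over the vertices v with x ≺₁ v ≼₁ y: the constraint that fixed x₁ v
    -- comes from an earlier vertex, whose weight is at least twice that of v.
    x₁-near : ∀ {x y v} → Acc _≺₁_ v → side x ≡ true → side y ≡ false → Adj G x y
      → x ≺₁ v → v ≺₁ y ⊎ v ≡ y → x₁ v + weight v ≤ x₁ x + two
    x₁-near {x} {y} {v} (acc rec) sx sy xy x≺v v≼y =
      subst (λ t → t + weight v ≤ x₁ x + two) (≡-sym (x₁-unfold v))
        (by-cases (argmax-sel (λ c → c) 0ℚ (constraints x₁ v)))
      where
      m≤x₁x : ∀ {m} → m ≤ x₁ x → (m + weight v) + weight v ≤ x₁ x + two
      m≤x₁x {m} m≤ = p+w+w≤q m (weight v) (+-monoˡ-≤ two m≤) (½^k+½^k≤2 (rank v))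

      by-cases : ∀ {m} → m ≡ 0ℚ ⊎ m ∈ constraints x₁ v → (m + weight v) + weight v ≤ x₁ x + two
      by-cases (inj₁ refl) = m≤x₁x (x₁-nonneg x)
      by-cases (inj₂ m∈) with ∈-constraints⁻ m∈
      ... | inj₁ (u , u≺v , refl) with ≺₁.compare x u
      ...   | tri< x≺u _ _ = p+w+w≤q (x₁ u) (weight v)
                (x₁-near (rec u≺v) sx sy xy x≺u (inj₁ (u≺y v≼y)))
                (m<k⇒½^k+½^k≤½^m (rank-mono u≺v))
        where
        u≺y : v ≺₁ y ⊎ v ≡ y → u ≺₁ y
        u≺y (inj₁ v≺y) = ≺₁.trans u≺v v≺y
        u≺y (inj₂ refl) = u≺v
      ...   | tri≈ _ refl _ = m≤x₁x ≤-refl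
      ...   | tri> _ _ u≺x = m≤x₁x (<⇒≤ (x₁-mono u≺x))
      by-cases (inj₂ m∈) | inj₂ (a , sep@(_ , sv , _) , refl) = p+w+w≤q (x₁ a + two) (weight v)
        (subst (_≤ x₁ x + two) (≡-sym (p+2+q≡p+q+2 (x₁ a) (weight x)))
          (+-monoˡ-≤ two (x₁-step (separated-≺₁-neighbours sep sx
            (adj-moveʳ (trans sv (≡-sym sy)) x≺v v≼y xy)))))
        (m<k⇒½^k+½^k≤½^m (rank-mono x≺v))

    x₁-adjacent : ∀ {x y} → side x ≡ true → Adj G x y → x₁ y < x₁ x + two
    x₁-adjacent {x} {y} sx xy = p+w≤q⇒p<q
      (x₁-near (⊏-wellFounded y) sx sy xy (X-first sx xy) (inj₂ refl)) (0<½^ (rank y))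
      where
      sy : side y ≡ false
      sy = trans (¬-not (bip y x (Graph.sym G xy))) (cong not sx)

    X-≺₂⇒≺₁ : ∀ {u v} → side u ≡ true → u ≺₂ v → u ≺₁ v
    X-≺₂⇒≺₁ {u} {v} su u≺₂v with ≺₁.compare u v
    ... | tri< u≺₁v _ _ = u≺₁v
    ... | tri≈ _ refl _ = ⊥-elim (≺₂.irrefl refl u≺₂v)
    ... | tri> _ _ v≺₁u = ⊥-elim (≺₁.asym v≺₁u (X-first su (Graph.sym G (≺₁-≻₂⇒adj v≺₁u u≺₂v))))

    shift : Bool → ℚ → ℚ
    shift true q = q + 1ℚ
    shift false q = q - 1ℚ

    x₂ : Fin n → ℚ
    x₂ v = shift (side v) (x₁ v)

    x₂-mono : ∀ {u v} → u ≺₂ v → x₂ u < x₂ v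
    x₂-mono {u} {v} u≺v with side u in su | side v in sv
    ... | true  | true  = +-monoˡ-< 1ℚ (x₁-mono (sameSide-≺₂⇒≺₁ (trans su (≡-sym sv)) u≺v))
    ... | false | false = +-monoˡ-< (- 1ℚ) (x₁-mono (sameSide-≺₂⇒≺₁ (trans su (≡-sym sv)) u≺v))
    ... | true  | false = p+2<q⇒p+1<q-1 (x₁ u) (x₁-separated (su , sv , X-≺₂⇒≺₁ su u≺v , u≺v))
    ... | false | true with ≺₁.compare u v
    ...   | tri< u≺₁v _ _ = p<q⇒p-1<q+1 (x₁-mono u≺₁v)
    ...   | tri≈ _ refl _ = ⊥-elim (≺₂.irrefl refl u≺v)
    ...   | tri> _ _ v≺₁u = q<p+2⇒q-1<p+1 (x₁ v) (x₁-adjacent sv (≺₁-≻₂⇒adj v≺₁u u≺v))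

corollary2p12 : (n : ℕ) (G : Graph n) (side : Fin n → Bool)
    → Connected G → IsBipartition G side
    → (≺₁ ≺₂ : LinearOrder n) → DefinesPermGraph G (proj₁ ≺₁) (proj₁ ≺₂)
    → (f : Fin n) → IsFirst (proj₁ ≺₁) f → side f ≡ true
    → Σ (Fin n → ℚ) λ x₁ → Σ (Fin n → ℚ) λ x₂ →
        IsPermDiagram G x₁ x₂ × Consistent x₁ (proj₁ ≺₁) × Consistent x₂ (proj₁ ≺₂)
        × (∀ x → side x ≡ true → x₂ x ≡ x₁ x + 1ℚ)
        × (∀ y → side y ≡ false → x₂ y ≡ x₁ y - 1ℚ)
corollary2p12 n G side conn bip O₁ O₂ dpg f first sf =
  x₁ , x₂ , consistent⇒IsPermDiagram G O₁ O₂ dpg cons₁ cons₂ , cons₁ , cons₂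
  , (λ x sx → cong (λ b → shift b (x₁ x)) sx) , (λ y sy → cong (λ b → shift b (x₁ y)) sy)
  where
  open BipartitePermutationGraph G side bip O₁ O₂ dpg
  open Coordinates (X-precedes-neighbours conn first sf)
  cons₁ : Consistent x₁ _≺₁_
  cons₁ = strictlyMonotone⇒consistent (proj₂ O₁) x₁-mono
  cons₂ : Consistent x₂ _≺₂_
  cons₂ = strictlyMonotone⇒consistent (proj₂ O₂) x₂-mono
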